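{- Let $\mathbb{F}$ be a field. There are noncommutative p-families $f$ and $g$ such that $f\leq_{iproj} g$ but $f\not\leq_{proj} g$.
   Context: A p-family is a sequence $f=(f_n)$ of noncommutative polynomials $f_n\in\mathbb{F}\langle X_n\rangle$ whose number of variables and degree are bounded by $n^c$. For $f_n\in\mathbb{F}\langle X_n\rangle$ and $g_n\in\mathbb{F}\langle Y_n\rangle$ with $\deg g_n=d'_n$: $f\leq_{proj}g$ if there are a polynomial $p(n)$ and maps $\phi:Y_{p(n)}\to X_n\cup\mathbb{F}$ with $f_n=g_{p(n)}(\phi(Y_{p(n)}))$; $f\leq_{iproj} g$ if there are a polynomial $p(n)$ and maps $\phi:[d'_{p(n)}]\times Y_{p(n)}\to X_n\cup\mathbb{F}$ such that substituting $\phi(i,y)$ for each variable $y$ occurring in position $i$ of each monomial of $g_{p(n)}$ yields $f_n$. -}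

module Defs where

open import Level using (Level; _⊔_; suc)
open import Algebra.Bundles using (CommutativeRing)
open import Data.Nat as ℕ using (ℕ; zero; _^_; _<_; _≤_; _≟_)
open import Data.Nat.Properties using (_<?_)
open import Data.Fin using (Fin; fromℕ<)
import Data.Fin.Properties as FinP
open import Data.List using (List; []; _∷_; length)
open import Data.List.Properties using (≡-dec)
open import Data.Product using (Σ; _×_; _,_; ∃; ∃-syntax)
open import Data.Sum using (_⊎_; inj₁; inj₂)
open import Relation.Nullary using (¬_; yes; no)
open import Relation.Binary.PropositionalEquality using (_≡_)

record Field (c ℓ : Level) : Set (Level.suc (c ⊔ ℓ)) where
  field
    commutativeRing : CommutativeRing c ℓ
  open CommutativeRing commutativeRing public
  field
    0≉1     : ¬ (0# ≈ 1#)
    inverse : ∀ x → ¬ (x ≈ 0#) → ∃[ y ] (x * y ≈ 1#)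

-- A monomial is a word (List (Fin k)); a polynomial is given by a
-- finite formal sum (list of coefficient/word terms).  Two such sums
-- denote the same polynomial iff every word gets equivalent total
-- coefficient.

module _ {c ℓ} (F : Field c ℓ) where
  open Field F

  Word : ℕ → Set
  Word k = List (Fin k)

  NCPoly : ℕ → Set c
  NCPoly k = List (Carrier × Word k)

  coeff : ∀ {k} → NCPoly k → Word k → Carrier
  coeff [] w = 0#
  coeff ((a , u) ∷ p) w with ≡-dec FinP._≟_ u w
  ... | yes _ = a + coeff p w
  ... | no  _ = coeff p w

  _≋_ : ∀ {k} → NCPoly k → NCPoly k → Set ℓ
  p ≋ q = ∀ w → coeff p w ≈ coeff q w

  DegreeAtMost : ∀ {k} → NCPoly k → ℕ → Set ℓ
  DegreeAtMost p d = ∀ w → d < length w → coeff p w ≈ 0#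

  -- deg p = d (with the convention deg 0 = 0)
  IsDegree : ∀ {k} → NCPoly k → ℕ → Set ℓ
  IsDegree p d = DegreeAtMost p d × (∀ e → DegreeAtMost p e → d ≤ e)

  -- The image of a term a·y₁⋯y_m under a (possibly position dependent)
  -- substitution: constants are multiplied into the coefficient (they
  -- are central), variables stay in the word in their order.

  substWord : ∀ {k k'} → (ℕ → Fin k → Fin k' ⊎ Carrier) → ℕ →
              Word k → Carrier × Word k'
  substWord σ i [] = 1# , []
  substWord σ i (y ∷ w) with σ i y | substWord σ (ℕ.suc i) w
  ... | inj₁ x | (b , v) = b , x ∷ v
  ... | inj₂ a | (b , v) = a * b , v

  substPos : ∀ {k k'} → (ℕ → Fin k → Fin k' ⊎ Carrier) →
             NCPoly k → NCPoly k'
  substPos σ [] = []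
  substPos σ ((a , w) ∷ p) with substWord σ 0 w
  ... | (b , v) = (a * b , v) ∷ substPos σ p

  subst : ∀ {k k'} → (Fin k → Fin k' ⊎ Carrier) → NCPoly k → NCPoly k'
  subst φ = substPos (λ _ y → φ y)

  -- Positions are
  -- 0-based here (position i+1 of the paper is index i).  Positions
  -- ≥ d only occur in monomials with zero coefficient when d = deg,
  -- so their (arbitrary) image 0 does not affect the result.
  isubst : ∀ {k k'} (d : ℕ) → (Fin d → Fin k → Fin k' ⊎ Carrier) →
           NCPoly k → NCPoly k'
  isubst d φ = substPos σ
    where
    σ : ℕ → _ → _
    σ i y with i <? d
    ... | yes i<d = φ (fromℕ< i<d) y
    ... | no  _   = inj₂ 0#

  record PFamily : Set (c ⊔ ℓ) where
    field
      nvars     : ℕ → ℕ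
      poly      : (n : ℕ) → NCPoly (nvars n)
      bound     : ℕ
      nvars≤    : ∀ n → nvars n ≤ n ^ bound
      degree≤   : ∀ n → DegreeAtMost (poly n) (n ^ bound)

  open PFamily

  PolyBounded : (ℕ → ℕ) → Set
  PolyBounded p = ∃[ e ] (∀ n → p n ≤ n ^ e ℕ.+ e)

  _≤proj_ : PFamily → PFamily → Set (c ⊔ ℓ)
  f ≤proj g =
    ∃[ p ] (PolyBounded p ×
      (∀ n → ∃[ φ ] (subst {nvars g (p n)} {nvars f n} φ (poly g (p n))
                       ≋ poly f n)))

  _≤iproj_ : PFamily → PFamily → Set (c ⊔ ℓ)
  f ≤iproj g =
    ∃[ p ] (PolyBounded p ×
      (∀ n → ∃[ d ] (IsDegree (poly g (p n)) d ×
        ∃[ φ ] (isubst {nvars g (p n)} {nvars f n} d φ (poly g (p n))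
                  ≋ poly f n))))

-- The family g_n = y² in one variable projects only onto squares x² and constants, so it never
-- yields f_n = x₀x₁; a position-dependent substitution, however, sends the first y to x₀ and
-- the second to x₁. Both families are zero for n < 2, where n^c cannot bound a degree of 2.
module Submission where

open import Defs
open import Level using (Level)
import Relation.Binary.Reasoning.Setoid as ≈-Reasoning
open import Data.Product using (∃-syntax; _×_; _,_)
open import Relation.Nullary using (¬_; yes; no; contradiction)
open import Data.Nat using (ℕ; zero; suc; _≤_; _≤?_; z≤n; s≤s; _^_)
open import Data.Nat.Properties using (≤-trans; ≤-reflexive; <⇒≢; ≤-refl; ≰⇒>; m≤m+n; ^-identityʳ)
open import Data.Fin using (Fin)
import Data.Fin as Fin
import Data.Fin.Properties as FinP
open import Data.List using ([]; _∷_; length)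
open import Data.List.Properties using (≡-dec)
open import Data.Sum using (_⊎_; inj₁; inj₂)
open import Relation.Binary.PropositionalEquality as ≡ using (_≢_; cong)

n≤n^1 : ∀ n → n ≤ n ^ 1
n≤n^1 n = ≤-reflexive (≡.sym (^-identityʳ n))

module _ {c ℓ} (F : Field c ℓ) where
  open Field F

  coeff-singleton-≢ : ∀ {k} a (u w : Word F k) → u ≢ w → coeff F ((a , u) ∷ []) w ≈ 0#
  coeff-singleton-≢ a u w u≢w with ≡-dec FinP._≟_ u w
  ... | yes u≡w = contradiction u≡w u≢w
  ... | no  _   = refl

  coeff-singleton-≡ : ∀ {k} a (u : Word F k) → coeff F ((a , u) ∷ []) u ≈ a
  coeff-singleton-≡ a u with ≡-dec FinP._≟_ u u
  ... | yes _   = +-identityʳ a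
  ... | no  u≢u = contradiction ≡.refl u≢u

  singleton-cong : ∀ {k} {a b} (u : Word F k) → a ≈ b → _≋_ F ((a , u) ∷ []) ((b , u) ∷ [])
  singleton-cong u a≈b w with ≡-dec FinP._≟_ u w
  ... | yes _ = +-congʳ a≈b
  ... | no  _ = refl

  singleton-degreeAtMost : ∀ {k} a (u : Word F k) {d} → length u ≤ d →
                           DegreeAtMost F ((a , u) ∷ []) d
  singleton-degreeAtMost a u u≤d w d<w =
    coeff-singleton-≢ a u w λ u≡w → <⇒≢ (≤-trans (s≤s u≤d) d<w) (cong length u≡w)

  singleton-isDegree : ∀ {k} {a} (u : Word F k) → ¬ a ≈ 0# →
                       IsDegree F ((a , u) ∷ []) (length u)
  singleton-isDegree {a = a} u a≉0 = singleton-degreeAtMost a u ≤-refl , minimal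
    where
    minimal : ∀ e → DegreeAtMost F ((a , u) ∷ []) e → length u ≤ e
    minimal e deg≤e with length u ≤? e
    ... | yes u≤e = u≤e
    ... | no  u≰e = contradiction (trans (sym (coeff-singleton-≡ a u)) (deg≤e u (≰⇒> u≰e))) a≉0

  []-isDegree : ∀ {k} → IsDegree F {k} [] 0
  []-isDegree = (λ _ _ → refl) , (λ _ _ → z≤n)

  -- A substitution turns y² into x² (y ↦ x) or into a constant (y ↦ a).
  coeff-subst-square : ∀ {k k'} (φ : Fin k → Fin k' ⊎ Carrier) a y {x x' : Fin k'} → x ≢ x' →
                       coeff F (subst F φ ((a , y ∷ y ∷ []) ∷ [])) (x ∷ x' ∷ []) ≈ 0#
  coeff-subst-square φ a y {x} {x'} x≢x' with φ y
  ... | inj₁ z = coeff-singleton-≢ _ (z ∷ z ∷ []) (x ∷ x' ∷ []) λ { ≡.refl → x≢x' ≡.refl }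
  ... | inj₂ b = coeff-singleton-≢ (a * (b * 1#)) [] (x ∷ x' ∷ []) λ ()

  eventuallyMonomial : ∀ k → Carrier → (u : Word F k) → k ≤ 2 → length u ≤ 2 → PFamily F
  eventuallyMonomial k a u k≤2 u≤2 = record
    { nvars = nvars ; poly = poly ; bound = 1 ; nvars≤ = nvars≤ ; degree≤ = degree≤ }
    where
    nvars : ℕ → ℕ
    nvars (suc (suc _)) = k
    nvars _             = 0

    poly : ∀ n → NCPoly F (nvars n)
    poly zero          = []
    poly (suc zero)    = []
    poly (suc (suc n)) = (a , u) ∷ []

    2≤n^1 : ∀ n → 2 ≤ suc (suc n) ^ 1
    2≤n^1 n = ≤-trans (s≤s (s≤s z≤n)) (n≤n^1 (suc (suc n)))

    nvars≤ : ∀ n → nvars n ≤ n ^ 1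
    nvars≤ zero          = z≤n
    nvars≤ (suc zero)    = z≤n
    nvars≤ (suc (suc n)) = ≤-trans k≤2 (2≤n^1 n)

    degree≤ : ∀ n → DegreeAtMost F (poly n) (n ^ 1)
    degree≤ zero          _ _ = refl
    degree≤ (suc zero)    _ _ = refl
    degree≤ (suc (suc n))     = singleton-degreeAtMost a u (≤-trans u≤2 (2≤n^1 n))

  x₀x₁-word : Word F 2
  x₀x₁-word = Fin.zero ∷ Fin.suc Fin.zero ∷ []

  y²-word : Word F 1
  y²-word = Fin.zero ∷ Fin.zero ∷ []

  x₀x₁ : PFamily F
  x₀x₁ = eventuallyMonomial 2 1# x₀x₁-word ≤-refl ≤-refl

  y² : PFamily F
  y² = eventuallyMonomial 1 1# y²-word (s≤s z≤n) ≤-refl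

  1≉0 : ¬ 1# ≈ 0#
  1≉0 1≈0 = 0≉1 (sym 1≈0)

  x₀x₁-≤iproj-y² : _≤iproj_ F x₀x₁ y²
  x₀x₁-≤iproj-y² = (λ n → n) , (1 , λ n → ≤-trans (n≤n^1 n) (m≤m+n _ 1)) , reduction
    where
    open PFamily
    reduction : ∀ n → ∃[ d ] (IsDegree F (poly y² n) d ×
                  ∃[ φ ] (_≋_ F (isubst F d φ (poly y² n)) (poly x₀x₁ n)))
    reduction zero          = 0 , []-isDegree , (λ _ _ → inj₂ 0#) , λ _ → refl
    reduction (suc zero)    = 0 , []-isDegree , (λ _ _ → inj₂ 0#) , λ _ → refl
    reduction (suc (suc n)) = 2 , singleton-isDegree y²-word 1≉0 , (λ i _ → inj₁ i) ,
                              singleton-cong x₀x₁-word (*-identityˡ 1#)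

  x₀x₁-≰proj-y² : ¬ _≤proj_ F x₀x₁ y²
  x₀x₁-≰proj-y² (p , _ , reduction) with reduction 2
  ... | φ , φ[y²]≋x₀x₁ = 1≉0 (begin
    1#                                                    ≈⟨ coeff-singleton-≡ 1# x₀x₁-word ⟨
    coeff F (PFamily.poly x₀x₁ 2) x₀x₁-word               ≈⟨ φ[y²]≋x₀x₁ x₀x₁-word ⟨
    coeff F (subst F φ (PFamily.poly y² (p 2))) x₀x₁-word ≈⟨ noSquareTerm (p 2) φ ⟩
    0#                                                    ∎)
    where
    open ≈-Reasoning setoid

    noSquareTerm : ∀ m (ψ : Fin (PFamily.nvars y² m) → Fin 2 ⊎ Carrier) →
                   coeff F (subst F ψ (PFamily.poly y² m)) x₀x₁-word ≈ 0#
    noSquareTerm zero          _ = refl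
    noSquareTerm (suc zero)    _ = refl
    noSquareTerm (suc (suc m)) ψ = coeff-subst-square ψ 1# Fin.zero λ ()

mainTheorem15 : ∀ {c ℓ : Level} (F : Field c ℓ) →
    ∃[ f ] ∃[ g ] (_≤iproj_ F f g × ¬ (_≤proj_ F f g))
mainTheorem15 F = x₀x₁ F , y² F , x₀x₁-≤iproj-y² F , x₀x₁-≰proj-y² F
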